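{- Let $Y$ be a multigraph (multiple edges allowed, no loops). Then $Y$ is a generalized truncation of some reflexive multigraph if and only if $Y$ contains a perfect matching $M$ such that the submultigraph $Y\setminus M$, obtained from $Y$ by deleting the edges of $M$, is a graph (i.e. has no multiple edges).
   Context: A reflexive multigraph may have loops and multiple edges; a multigraph may have multiple edges but no loops; a graph has neither loops nor multiple edges. Reflexive multigraphs from which generalized truncations are formed are assumed to have no isolated vertices. Generalized truncation: let $X$ be a reflexive multigraph. Take a matching $M_0$ (pairwise vertex-disjoint edges, on $2|E(X)|$ new vertices) with $|M_0|=|E(X)|$ and a bijection $F:E(X)\to M_0$; for each edge $e$ of $X$ with ends $u,v$, label one end of $F(e)$ by $u$ and the other by $v$ (a loop at $v$ gives an edge with both ends labelled $v$). For $v\in V(X)$, the cluster $\mathrm{cl}(v)$ is the set of vertices of $M_0$ labelled $v$. On each $\mathrm{cl}(v)$ insert an arbitrary graph $\mathrm{con}(v)$ (the constituent at $v$). The multigraph $F(M_0)\cup\bigcup_{v\in V(X)}\mathrm{con}(v)$, and any multigraph isomorphic to it, is called a generalized truncation of $X$. -}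

module Defs where

open import Data.Nat using (ℕ)
open import Data.Fin using (Fin)
open import Data.Bool using (Bool; true; false)
open import Data.Product using (Σ; ∃; _×_; _,_; proj₁; proj₂)
open import Data.Sum using (_⊎_; inj₁; inj₂)
open import Relation.Binary.PropositionalEquality using (_≡_)
open import Relation.Nullary using (¬_)
open import Function.Bundles using (_⤖_; Bijection)

SameEnds : {A : Set} → A × A → A × A → Set
SameEnds (a , b) (c , d) = (a ≡ c × b ≡ d) ⊎ (a ≡ d × b ≡ c)

-- A general (reflexive) multigraph: vertex set, edge set, and for each edge
-- its (unordered) pair of ends; an edge e with both ends equal is a loop.
record MG : Set₁ where
  field
    V    : Set
    E    : Set
    ends : E → V × V
open MG public

mapPair : {A B : Set} → (A → B) → A × A → B × B
mapPair f (a , b) = (f a , f b)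

record Iso (G H : MG) : Set where
  field
    isoV     : V G ⤖ V H
    isoE     : E G ⤖ E H
    preserve : ∀ e → SameEnds (mapPair (Bijection.to isoV) (ends G e))
                              (ends H (Bijection.to isoE e))

finMG : (n m : ℕ) → (Fin m → Fin n) → (Fin m → Fin n) → MG
finMG n m s t = record { V = Fin n ; E = Fin m ; ends = λ e → (s e , t e) }

-- A finite reflexive multigraph (loops and multiple edges allowed),
-- with no isolated vertices (standing assumption for generalized truncations).
record RMG : Set where
  field
    nV   : ℕ
    nE   : ℕ
    end₁ : Fin nE → Fin nV
    end₂ : Fin nE → Fin nV
    noIsolated : ∀ (v : Fin nV) → ∃ λ e → (end₁ e ≡ v) ⊎ (end₂ e ≡ v)
open RMG public

-- Vertices of M₀: two per edge of X; (e , false) and (e , true) are the ends of F(e).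
M₀V : RMG → Set
M₀V X = Fin (nE X) × Bool

label : (X : RMG) → M₀V X → Fin (nV X)
label X (e , false) = end₁ X e
label X (e , true)  = end₂ X e

-- The union of the constituents con(v), v ∈ V(X): a finite set of edges, each
-- joining two distinct vertices of the same cluster cl(v) (same label),
-- with no two edges joining the same pair (each con(v) is a graph).
record Constituents (X : RMG) : Set where
  field
    k      : ℕ
    c₁ c₂  : Fin k → M₀V X
    sameCluster : ∀ i → label X (c₁ i) ≡ label X (c₂ i)
    noLoop      : ∀ i → ¬ (c₁ i ≡ c₂ i)
    noMulti     : ∀ i j → SameEnds (c₁ i , c₂ i) (c₁ j , c₂ j) → i ≡ j
open Constituents public

truncation : (X : RMG) → Constituents X → MG
truncation X C = record
  { V = M₀V X
  ; E = Fin (nE X) ⊎ Fin (k C)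
  ; ends = λ { (inj₁ e) → ((e , false) , (e , true))
             ; (inj₂ i) → (c₁ C i , c₂ C i) } }

IsGenTruncOf : MG → RMG → Set
IsGenTruncOf G X = Σ (Constituents X) λ C → Iso (truncation X C) G

IsGenTrunc : MG → Set
IsGenTrunc G = Σ RMG λ X → IsGenTruncOf G X

Incident : {n m : ℕ} → (Fin m → Fin n) → (Fin m → Fin n) → Fin n → Fin m → Set
Incident s t v e = (s e ≡ v) ⊎ (t e ≡ v)

IsPerfectMatching : {n m : ℕ} → (Fin m → Fin n) → (Fin m → Fin n) → (Fin m → Bool) → Set
IsPerfectMatching {n} {m} s t M =
  ∀ (v : Fin n) → (∃ λ e → M e ≡ true × Incident s t v e)
                × (∀ e f → M e ≡ true → M f ≡ true → Incident s t v e → Incident s t v f → e ≡ f)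

-- Y ∖ M has no multiple edges (it has no loops since Y has none).
DeletionIsGraph : {n m : ℕ} → (Fin m → Fin n) → (Fin m → Fin n) → (Fin m → Bool) → Set
DeletionIsGraph s t M =
  ∀ e f → M e ≡ false → M f ≡ false → SameEnds (s e , t e) (s f , t f) → e ≡ f

module Submission where

-- In a generalized truncation the edges of M₀ form a perfect matching (the vertex (e , b) lies
-- on the matching edge e only), and the remaining edges are those of the constituents, among
-- which there are no parallel edges; both properties are invariant under isomorphism.
-- Conversely, given such an M, the two ends of the edges of M enumerate the vertices of Y
-- bijectively (Y has no loops), so Y is the generalized truncation of the bouquet of |M| loops
-- at one vertex whose single constituent is Y ∖ M.

open import Defs
open import Data.Nat using (ℕ; zero; suc; _⊓_)
open import Data.Fin using (Fin; zero; suc)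
open import Data.Fin.Properties using (+↔⊎)
open import Data.Bool using (Bool; true; false; not)
open import Data.Bool.Properties using (not-involutive; not-injective)
open import Data.Product using (Σ; ∃; _×_; _,_; proj₁; proj₂)
open import Data.Sum using (_⊎_; inj₁; inj₂; swap)
open import Data.Empty using (⊥-elim)
open import Data.Sum.Algebra using (⊎-assoc)
open import Data.Sum.Properties using (swap-↔; inj₁-injective; inj₂-injective)
open import Data.Sum.Function.Propositional using (_⊎-↔_)
open import Function using (_∘_; case_of_)
open import Function.Bundles using (_⇔_; _↔_; _⤖_; Inverse; Bijection; Injection; mk⇔; mk⤖)
open import Function.Construct.Composition using (_↔-∘_)
open import Function.Properties.Bijection using (⤖⇒↔)
open import Function.Consequences.Propositional using (strictlySurjective⇒surjective)
open import Function.Properties.Inverse using (↔-refl; ↔-sym; ↔⇒⤖; ↔⇒↣)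
open import Relation.Binary.PropositionalEquality
  using (_≡_; refl; sym; trans; cong; cong₂; subst; subst₂; module ≡-Reasoning)
open import Relation.Nullary using (¬_)

private
  variable
    A B : Set

SameEnds-refl : {p : A × A} → SameEnds p p
SameEnds-refl = inj₁ (refl , refl)

SameEnds-sym : {p q : A × A} → SameEnds p q → SameEnds q p
SameEnds-sym (inj₁ (refl , refl)) = inj₁ (refl , refl)
SameEnds-sym (inj₂ (refl , refl)) = inj₂ (refl , refl)

SameEnds-trans : {p q r : A × A} → SameEnds p q → SameEnds q r → SameEnds p r
SameEnds-trans (inj₁ (refl , refl)) qr                   = qr
SameEnds-trans (inj₂ (refl , refl)) (inj₁ (refl , refl)) = inj₂ (refl , refl)
SameEnds-trans (inj₂ (refl , refl)) (inj₂ (refl , refl)) = inj₁ (refl , refl)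

SameEnds-map : (f : A → B) {p q : A × A} → SameEnds p q → SameEnds (mapPair f p) (mapPair f q)
SameEnds-map f (inj₁ (refl , refl)) = inj₁ (refl , refl)
SameEnds-map f (inj₂ (refl , refl)) = inj₂ (refl , refl)

mapPair-inverse : (f : B → A) (g : A → B) → (∀ x → f (g x) ≡ x) →
                  ∀ p → mapPair f (mapPair g p) ≡ p
mapPair-inverse f g fg (x , y) = cong₂ _,_ (fg x) (fg y)

_∈ends_ : A → A × A → Set
x ∈ends (a , b) = (a ≡ x) ⊎ (b ≡ x)

end : A × A → Bool → A
end (a , b) false = a
end (a , b) true  = b

∈ends-SameEnds : {x : A} {p q : A × A} → SameEnds p q → x ∈ends p → x ∈ends q
∈ends-SameEnds (inj₁ (refl , refl)) x∈p        = x∈p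
∈ends-SameEnds (inj₂ (refl , refl)) (inj₁ a≡x) = inj₂ a≡x
∈ends-SameEnds (inj₂ (refl , refl)) (inj₂ b≡x) = inj₁ b≡x

∈ends-map : (f : A → B) {x : A} {p : A × A} → x ∈ends p → f x ∈ends mapPair f p
∈ends-map f (inj₁ refl) = inj₁ refl
∈ends-map f (inj₂ refl) = inj₂ refl

∈ends-unmap : {f : A → B} → (∀ {x y} → f x ≡ f y → x ≡ y) →
              {x : A} {p : A × A} → f x ∈ends mapPair f p → x ∈ends p
∈ends-unmap f-inj (inj₁ fa≡fx) = inj₁ (f-inj fa≡fx)
∈ends-unmap f-inj (inj₂ fb≡fx) = inj₂ (f-inj fb≡fx)

end-∈ends : (p : A × A) (b : Bool) → end p b ∈ends p
end-∈ends p false = inj₁ refl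
end-∈ends p true  = inj₂ refl

∈ends⇒end : {x : A} {p : A × A} → x ∈ends p → ∃ λ b → end p b ≡ x
∈ends⇒end (inj₁ a≡x) = false , a≡x
∈ends⇒end (inj₂ b≡x) = true , b≡x

end-injective : {p : A × A} → ¬ (proj₁ p ≡ proj₂ p) → ∀ {b c} → end p b ≡ end p c → b ≡ c
end-injective a≢b {false} {false} _   = refl
end-injective a≢b {true}  {true}  _   = refl
end-injective a≢b {false} {true}  a≡b = ⊥-elim (a≢b a≡b)
end-injective a≢b {true}  {false} b≡a = ⊥-elim (a≢b (sym b≡a))

-- On finMG n m s t, IsPerfectMatchingOf and DeletionIsGraphOf unfold to IsPerfectMatching s t
-- and DeletionIsGraph s t.
IncidentTo : (G : MG) → V G → E G → Set
IncidentTo G v e = v ∈ends ends G e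

Loopless : MG → Set
Loopless G = ∀ e → ¬ (proj₁ (ends G e) ≡ proj₂ (ends G e))

IsPerfectMatchingOf : (G : MG) → (E G → Bool) → Set
IsPerfectMatchingOf G M =
  ∀ v → (∃ λ e → M e ≡ true × IncidentTo G v e)
      × (∀ e f → M e ≡ true → M f ≡ true → IncidentTo G v e → IncidentTo G v f → e ≡ f)

DeletionIsGraphOf : (G : MG) → (E G → Bool) → Set
DeletionIsGraphOf G M =
  ∀ e f → M e ≡ false → M f ≡ false → SameEnds (ends G e) (ends G f) → e ≡ f

Iso-sym : {G H : MG} → Iso G H → Iso H G
Iso-sym {G} {H} I = record
  { isoV     = ↔⇒⤖ (↔-sym vert)
  ; isoE     = ↔⇒⤖ (↔-sym edge)
  ; preserve = λ e → SameEnds-sym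
      (subst₂ SameEnds (mapPair-inverse fromV toV fromV∘toV (ends G (fromE e)))
                       (cong (mapPair fromV ∘ ends H) (toE∘fromE e))
                       (SameEnds-map fromV (Iso.preserve I (fromE e))))
  }
  where
  vert = ⤖⇒↔ (Iso.isoV I)
  edge = ⤖⇒↔ (Iso.isoE I)
  toV : V G → V H
  toV = Inverse.to vert
  fromV : V H → V G
  fromV = Inverse.from vert
  fromE : E H → E G
  fromE = Inverse.from edge
  fromV∘toV : ∀ v → fromV (toV v) ≡ v
  fromV∘toV = Inverse.strictlyInverseʳ vert
  toE∘fromE : ∀ e → Inverse.to edge (fromE e) ≡ e
  toE∘fromE = Inverse.strictlyInverseˡ edge

module _ {G H : MG} (I : Iso G H) where
  open Iso I
  private
    toV = Bijection.to isoV
    toE = Bijection.to isoE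

  incident-preserved : ∀ {v e} → IncidentTo G v e → IncidentTo H (toV v) (toE e)
  incident-preserved = ∈ends-SameEnds (preserve _) ∘ ∈ends-map toV

  incident-reflected : ∀ {v e} → IncidentTo H (toV v) (toE e) → IncidentTo G v e
  incident-reflected =
    ∈ends-unmap (Bijection.injective isoV) ∘ ∈ends-SameEnds (SameEnds-sym (preserve _))

  perfectMatching-pullback : ∀ {M} → IsPerfectMatchingOf H M → IsPerfectMatchingOf G (M ∘ toE)
  perfectMatching-pullback {M} pm v = matched (proj₁ (pm (toV v))) , unique
    where
    matched : (∃ λ e′ → M e′ ≡ true × IncidentTo H (toV v) e′) →
              ∃ λ e → M (toE e) ≡ true × IncidentTo G v e
    matched (e′ , Me′ , v∈e′) with Bijection.strictlySurjective isoE e′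
    ... | e , refl = e , Me′ , incident-reflected v∈e′
    unique : ∀ e f → M (toE e) ≡ true → M (toE f) ≡ true →
             IncidentTo G v e → IncidentTo G v f → e ≡ f
    unique e f Me Mf v∈e v∈f = Bijection.injective isoE
      (proj₂ (pm (toV v)) _ _ Me Mf (incident-preserved v∈e) (incident-preserved v∈f))

  deletionIsGraph-pullback : ∀ {M} → DeletionIsGraphOf H M → DeletionIsGraphOf G (M ∘ toE)
  deletionIsGraph-pullback dg e f Me Mf e∼f = Bijection.injective isoE (dg _ _ Me Mf
    (SameEnds-trans (SameEnds-sym (preserve e)) (SameEnds-trans (SameEnds-map toV e∼f) (preserve f))))

isLeft : A ⊎ B → Bool
isLeft (inj₁ _) = true
isLeft (inj₂ _) = false

module _ (X : RMG) (C : Constituents X) where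

  matchingEdge-incident : ∀ {e b i} → IncidentTo (truncation X C) (e , b) (inj₁ i) → i ≡ e
  matchingEdge-incident (inj₁ i≡e) = cong proj₁ i≡e
  matchingEdge-incident (inj₂ i≡e) = cong proj₁ i≡e

  matchingEdge-∈ends : ∀ e b → IncidentTo (truncation X C) (e , b) (inj₁ e)
  matchingEdge-∈ends e false = inj₁ refl
  matchingEdge-∈ends e true  = inj₂ refl

  truncation-perfectMatching : IsPerfectMatchingOf (truncation X C) isLeft
  truncation-perfectMatching (e , b) = (inj₁ e , refl , matchingEdge-∈ends e b) , unique
    where
    unique : ∀ e′ f′ → isLeft e′ ≡ true → isLeft f′ ≡ true →
             IncidentTo (truncation X C) (e , b) e′ → IncidentTo (truncation X C) (e , b) f′ → e′ ≡ f′
    unique (inj₁ i) (inj₁ j) _ _ v∈i v∈j =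
      cong inj₁ (trans (matchingEdge-incident v∈i) (sym (matchingEdge-incident v∈j)))

  truncation-deletionIsGraph : DeletionIsGraphOf (truncation X C) isLeft
  truncation-deletionIsGraph (inj₂ i) (inj₂ j) _ _ i∼j = cong inj₂ (noMulti C i j i∼j)

genTrunc⇒matching : (G : MG) → IsGenTrunc G →
  Σ (E G → Bool) λ M → IsPerfectMatchingOf G M × DeletionIsGraphOf G M
genTrunc⇒matching G (X , C , I) =
  isLeft ∘ Bijection.to (Iso.isoE (Iso-sym I)) ,
  perfectMatching-pullback (Iso-sym I) (truncation-perfectMatching X C) ,
  deletionIsGraph-pullback (Iso-sym I) (truncation-deletionIsGraph X C)

record Partition {E : Set} (P : E → Bool) : Set where
  field
    #true #false : ℕ
    enum         : (Fin #true ⊎ Fin #false) ↔ E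
    enum-isLeft  : ∀ x → P (Inverse.to enum x) ≡ isLeft x
open Partition

isLeft-swap : (x : A ⊎ B) → isLeft (swap x) ≡ not (isLeft x)
isLeft-swap (inj₁ _) = refl
isLeft-swap (inj₂ _) = refl

partition-complement : {E : Set} {P Q : E → Bool} → (∀ e → P e ≡ not (Q e)) → Partition P → Partition Q
partition-complement {P = P} {Q} P≡¬Q π = record
  { #true       = #false π
  ; #false      = #true π
  ; enum        = enum π ↔-∘ swap-↔
  ; enum-isLeft = λ x → not-injective (begin
      not (Q (Inverse.to (enum π) (swap x))) ≡⟨ P≡¬Q _ ⟨
      P (Inverse.to (enum π) (swap x))       ≡⟨ enum-isLeft π (swap x) ⟩
      isLeft (swap x)                        ≡⟨ isLeft-swap x ⟩
      not (isLeft x)                         ∎)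
  }
  where open ≡-Reasoning

partition-suc : ∀ {m} {P : Fin (suc m) → Bool} → P zero ≡ true → Partition (P ∘ suc) → Partition P
partition-suc P0 π = record
  { #true       = suc (#true π)
  ; #false      = #false π
  ; enum        = ↔-sym +↔⊎ ↔-∘ ((↔-refl ⊎-↔ enum π) ↔-∘ (⊎-assoc _ _ _ _ ↔-∘ (+↔⊎ ⊎-↔ ↔-refl)))
  ; enum-isLeft = λ { (inj₁ zero)    → P0
                    ; (inj₁ (suc i)) → enum-isLeft π (inj₁ i)
                    ; (inj₂ j)       → enum-isLeft π (inj₂ j) }
  }

partition : ∀ {m} (P : Fin m → Bool) → Partition P
partition {zero} P = record
  { #true = 0 ; #false = 0 ; enum = ↔-sym +↔⊎ ; enum-isLeft = λ { (inj₁ ()) ; (inj₂ ()) } }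
-- When P zero ≡ false, the first element is put on the left of a partition of not ∘ P.
partition {suc m} P with P zero in P0
... | true  = partition-suc P0 (partition (P ∘ suc))
... | false = partition-complement (λ _ → refl)
                (partition-suc (cong not P0)
                  (partition-complement (λ _ → sym (not-involutive _)) (partition (P ∘ suc))))

partition-true : {E : Set} {P : E → Bool} (π : Partition P) →
  ∀ {e} → P e ≡ true → ∃ λ i → Inverse.to (enum π) (inj₁ i) ≡ e
partition-true {P = P} π {e} Pe =
  classify (Inverse.from (enum π) e) (Inverse.strictlyInverseˡ (enum π) e)
  where
  classify : ∀ x → Inverse.to (enum π) x ≡ e → ∃ λ i → Inverse.to (enum π) (inj₁ i) ≡ e
  classify (inj₁ i) x↦e = i , x↦e
  classify (inj₂ j) x↦e =
    case trans (sym Pe) (trans (cong P (sym x↦e)) (enum-isLeft π (inj₂ j))) of λ ()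

module _ {G : MG} (loopless : Loopless G) {M : E G → Bool}
         (pm : IsPerfectMatchingOf G M) (π : Partition M) where

  matchedEdge : Fin (#true π) → E G
  matchedEdge i = Inverse.to (enum π) (inj₁ i)

  matchedEnd : Fin (#true π) × Bool → V G
  matchedEnd (i , b) = end (ends G (matchedEdge i)) b

  matchedEdge-injective : ∀ {i j} → matchedEdge i ≡ matchedEdge j → i ≡ j
  matchedEdge-injective = inj₁-injective ∘ Injection.injective (↔⇒↣ (enum π))

  matchedEnd-sameEdge : ∀ {i j b c} → matchedEnd (i , b) ≡ matchedEnd (j , c) → i ≡ j
  matchedEnd-sameEdge {i} {j} {b} {c} same = matchedEdge-injective
    (proj₂ (pm (matchedEnd (i , b))) _ _ (enum-isLeft π (inj₁ i)) (enum-isLeft π (inj₁ j))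
      (end-∈ends _ b) (subst (_∈ends ends G (matchedEdge j)) (sym same) (end-∈ends _ c)))

  matchedEnd-injective : ∀ {x y} → matchedEnd x ≡ matchedEnd y → x ≡ y
  matchedEnd-injective {i , b} {j , c} same with matchedEnd-sameEdge {i} {j} {b} {c} same
  ... | refl = cong (i ,_) (end-injective (loopless (matchedEdge i)) same)

  matchedEnd-surjective : ∀ v → ∃ λ x → matchedEnd x ≡ v
  matchedEnd-surjective v with proj₁ (pm v)
  ... | e , Me , v∈e with partition-true π Me | ∈ends⇒end v∈e
  ...   | i , refl | b , b↦v = (i , b) , b↦v

  matchedEnds : (Fin (#true π) × Bool) ⤖ V G
  matchedEnds = mk⤖ (matchedEnd-injective , strictlySurjective⇒surjective matchedEnd-surjective)

-- A bouquet without loops has no vertex at all, as X may not have isolated vertices.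
hub : ∀ a → Fin a → Fin (1 ⊓ a)
hub (suc a) _ = zero

hub-unique : ∀ a (u v : Fin (1 ⊓ a)) → u ≡ v
hub-unique (suc a) zero zero = refl

loopAt : ∀ a → Fin (1 ⊓ a) → Fin a
loopAt (suc a) _ = zero

bouquet : ℕ → RMG
bouquet a = record
  { nV = 1 ⊓ a ; nE = a ; end₁ = hub a ; end₂ = hub a
  ; noIsolated = λ v → loopAt a v , inj₁ (hub-unique a _ v) }

module _ {G : MG} (loopless : Loopless G) {M : E G → Bool} (pm : IsPerfectMatchingOf G M)
         (dg : DeletionIsGraphOf G M) (π : Partition M) where

  private
    X = bouquet (#true π)
    vertices = ⤖⇒↔ (matchedEnds loopless pm π)
    toV : M₀V X → V G
    toV = Inverse.to vertices
    fromV : V G → M₀V X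
    fromV = Inverse.from vertices
    toV∘fromV : ∀ v → toV (fromV v) ≡ v
    toV∘fromV = Inverse.strictlyInverseˡ vertices
    unmatchedEdge : Fin (#false π) → E G
    unmatchedEdge j = Inverse.to (enum π) (inj₂ j)
    clusterEnds : Fin (#false π) → M₀V X × M₀V X
    clusterEnds j = mapPair fromV (ends G (unmatchedEdge j))

  unmatchedConstituents : Constituents X
  unmatchedConstituents = record
    { k           = #false π
    ; c₁          = proj₁ ∘ clusterEnds
    ; c₂          = proj₂ ∘ clusterEnds
    ; sameCluster = λ _ → hub-unique (#true π) _ _
    ; noLoop      = λ j same → loopless (unmatchedEdge j)
        (trans (sym (toV∘fromV _)) (trans (cong toV same) (toV∘fromV _)))
    ; noMulti     = λ i j i∼j → inj₂-injective (Injection.injective (↔⇒↣ (enum π))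
        (dg _ _ (enum-isLeft π (inj₂ i)) (enum-isLeft π (inj₂ j))
          (subst₂ SameEnds (mapPair-inverse toV fromV toV∘fromV _)
                           (mapPair-inverse toV fromV toV∘fromV _)
                           (SameEnds-map toV i∼j))))
    }

  matching⇒genTrunc : IsGenTrunc G
  matching⇒genTrunc = X , unmatchedConstituents , record
    { isoV     = matchedEnds loopless pm π
    ; isoE     = ↔⇒⤖ (enum π)
    ; preserve = λ { (inj₁ i) → SameEnds-refl
                   ; (inj₂ j) → inj₁ (toV∘fromV _ , toV∘fromV _) }
    }

theorem2p1 : (n m : ℕ) (s t : Fin m → Fin n) → (∀ e → ¬ (s e ≡ t e)) →
    IsGenTrunc (finMG n m s t)
      ⇔ Σ (Fin m → Bool) (λ M → IsPerfectMatching s t M × DeletionIsGraph s t M)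
theorem2p1 n m s t loopless = mk⇔
  (genTrunc⇒matching (finMG n m s t))
  (λ (M , pm , dg) → matching⇒genTrunc loopless pm dg (partition M))
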